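{- If $G$ is an $r$-cop-win graph ($r\in\{0,1\}$) of finite corner rank $\alpha\ge2$, then $\operatorname{capt}(G)\ge\alpha-r$.
   Context: All graphs are finite, nonempty and reflexive (every vertex adjacent to itself). For distinct vertices $v,w$ of a graph $H$, $w$ strictly corners $v$ in $H$ if every vertex of $H$ adjacent to $v$ is adjacent to $w$ and some vertex of $H$ adjacent to $w$ is not adjacent to $v$; a strict corner of $H$ is a vertex strictly cornered in $H$ by another vertex. Corner ranking: $G_1=G$, $k=1$. If $G_k$ is a clique, its vertices get rank $k$; stop. Else if $G_k$ has no strict corners, its vertices get rank $\infty$; stop. Else the set $X$ of strict corners of $G_k$ gets rank $k$, $G_{k+1}=G_k-X$, increase $k$, repeat. The corner rank of $G$ is the maximum rank. For finite corner rank $\alpha\ge2$: $G$ is $1$-cop-win if some (equivalently every) vertex of rank $\alpha$ is adjacent to all vertices of $G_{\alpha-1}$, otherwise $0$-cop-win. Game: cop places, robber places, then alternate moves with the cop first; a move is staying or moving to an adjacent vertex; the cop wins when both share a vertex. For cop-win $G$, $\operatorname{capt}(G)$ is the minimum number of cop moves (placement not counted) within which the cop can guarantee a win. -}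

module Defs where

open import Data.Nat using (ℕ; zero; suc; _<_; _≤_; _∸_)
open import Data.Fin using (Fin)
open import Data.Product using (Σ; _×_; Σ-syntax)
open import Data.Sum using (_⊎_)
open import Data.Unit using (⊤)
open import Data.Empty using (⊥)
open import Relation.Nullary using (¬_)
open import Relation.Binary using (Decidable)
open import Relation.Binary.PropositionalEquality using (_≡_; _≢_)

record Graph : Set₁ where
  field
    n        : ℕ
    nonempty : 0 < n
    Adj      : Fin n → Fin n → Set
    adj?     : Decidable Adj
    adj-refl : ∀ v → Adj v v
    adj-sym  : ∀ {u v} → Adj u v → Adj v u

module _ (G : Graph) where
  open Graph G

  -- induced subgraphs are given by their vertex sets (predicates)
  VSet : Set₁
  VSet = Fin n → Set

  StrictlyCorners : VSet → Fin n → Fin n → Set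
  StrictlyCorners S w v =
    S v × S w × w ≢ v
    × (∀ u → S u → Adj u v → Adj u w)
    × (Σ[ u ∈ Fin n ] (S u × Adj u w × ¬ Adj u v))

  StrictCorner : VSet → Fin n → Set
  StrictCorner S v = Σ[ w ∈ Fin n ] StrictlyCorners S w v

  HasStrictCorner : VSet → Set
  HasStrictCorner S = Σ[ v ∈ Fin n ] StrictCorner S v

  IsClique : VSet → Set
  IsClique S = ∀ u v → S u → S v → Adj u v

  -- stage k = vertex set of G_{k+1} in the corner ranking
  stage : ℕ → VSet
  stage zero    v = ⊤
  stage (suc k) v = stage k v × ¬ StrictCorner (stage k) v

  -- G_k for k ≥ 1 (vertex set)
  Gk : ℕ → VSet
  Gk k = stage (k ∸ 1)

  record HasCornerRank (α : ℕ) : Set where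
    field
      rank-pos : 1 ≤ α
      earlier  : ∀ k → 1 ≤ k → k < α → ¬ IsClique (Gk k) × HasStrictCorner (Gk k)
      final    : IsClique (Gk α)

  OneCopWinCond : ℕ → Set
  OneCopWinCond α = Σ[ v ∈ Fin n ] (Gk α v × (∀ u → Gk (α ∸ 1) u → Adj v u))

  RCopWin : ℕ → ℕ → Set
  RCopWin α zero          = ¬ OneCopWinCond α
  RCopWin α (suc zero)    = OneCopWinCond α
  RCopWin α (suc (suc _)) = ⊥

  -- Cop, to move, at c; robber at r: the cop can force capture within m cop moves.
  CopWinsFrom : ℕ → Fin n → Fin n → Set
  CopWinsFrom zero    c r = c ≡ r
  CopWinsFrom (suc m) c r =
    c ≡ r ⊎ (Σ[ c′ ∈ Fin n ] (Adj c c′ × (c′ ≡ r ⊎ (∀ r′ → Adj r r′ → CopWinsFrom m c′ r′))))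

  -- the cop can guarantee a win within m moves (placement not counted):
  -- cop places, robber places, then the cop moves first.
  CopCapturesWithin : ℕ → Set
  CopCapturesWithin m = Σ[ c₀ ∈ Fin n ] (∀ r₀ → CopWinsFrom m c₀ r₀)

  CaptAtLeast : ℕ → Set
  CaptAtLeast b = ∀ m → CopCapturesWithin m → b ≤ m

-- Following strict corners inside G_{m+1} ends (finiteness) at a vertex of G_{m+2} whose
-- neighbourhood contains that of the start; iterating gives maps retract m : V(G) → V(G_{m+1})
-- that preserve adjacency and only enlarge neighbourhoods within G_{m+1}. By induction on m,
-- a robber standing in G_{m+1} out of reach of the image of the cop survives m+1 cop moves: if
-- the cop could win after moving to c′, the image of c′ one level up would strictly corner the
-- robber in G_{m+1}. If some image is adjacent to all of G_{α-1}, then either G is 1-cop-win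
-- or G_α is a clique; so a 0-cop-win robber survives α-1 moves, and a 1-cop-win robber, using
-- that G_{α-1} is not a clique, survives α-2 moves.
module Submission where

open import Defs
open import Data.Nat using (ℕ; _≤_; _∸_)
open import Data.Nat using (zero; suc; z≤n; s≤s; _≤?_)
open import Data.Nat.Properties using (≤-refl; ≰⇒>)
open import Data.Fin using (Fin; _≟_)
open import Data.Fin.Properties using (any?; all?)
open import Data.Fin.Subset using (Subset; _∈_; _⊂_; _⊃_)
open import Data.Fin.Subset.Induction using (Acc; acc; ⊃-wellFounded)
open import Data.Vec using (tabulate)
open import Data.Vec.Properties using (lookup∘tabulate; lookup⇒[]=; []=⇒lookup)
open import Data.Product using (_×_; _,_; proj₁; proj₂; ∃-syntax)
open import Data.Sum using (inj₁; inj₂)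
open import Data.Unit using (tt)
open import Data.Empty using (⊥-elim)
open import Function using (_∘_)
open import Relation.Nullary using (¬_; yes; no; does)
open import Relation.Nullary.Decidable using (_×-dec_; _→-dec_; ¬?; dec-true; decidable-stable)
open import Relation.Unary using (Decidable)
open import Relation.Binary.PropositionalEquality using (_≡_; refl; sym; trans; subst; subst₂)

module _ {n} {P : Fin n → Set} (P? : Decidable P) where

  toSubset : Subset n
  toSubset = tabulate (does ∘ P?)

  ∈-toSubset⁺ : ∀ {i} → P i → i ∈ toSubset
  ∈-toSubset⁺ {i} p = lookup⇒[]= i toSubset (trans (lookup∘tabulate (does ∘ P?) i) (dec-true (P? i) p))

  ∈-toSubset⁻ : ∀ {i} → i ∈ toSubset → P i
  ∈-toSubset⁻ {i} i∈ with P? i | trans (sym (lookup∘tabulate (does ∘ P?) i)) ([]=⇒lookup i∈)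
  ... | yes p | _ = p
  ... | no _  | ()

module _ (G : Graph) where
  open Graph G

  Corners : VSet G → Fin n → Fin n → Set
  Corners S w v = ∀ u → S u → Adj u v → Adj u w

  AdjacentToAll : VSet G → Fin n → Set
  AdjacentToAll S y = ∀ u → S u → Adj y u

  strictCorner? : (S : VSet G) → Decidable S → Decidable (StrictCorner G S)
  strictCorner? S S? v = any? λ w → S? v ×-dec S? w ×-dec ¬? (w ≟ v)
    ×-dec all? (λ u → S? u →-dec (adj? u v →-dec adj? u w))
    ×-dec any? (λ u → S? u ×-dec adj? u w ×-dec ¬? (adj? u v))

  stage? : ∀ k → Decidable (stage G k)
  stage? zero    v = yes tt
  stage? (suc k) v = stage? k v ×-dec ¬? (strictCorner? (stage G k) (stage? k) v)

  record UncorneredAbove (S : VSet G) (v : Fin n) : Set where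
    field
      top            : Fin n
      top∈S          : S top
      top-uncornered : ¬ StrictCorner G S top
      top-corners    : Corners S top v

  module _ (S : VSet G) (S? : Decidable S) where

    inNbhd? : ∀ v → Decidable (λ u → S u × Adj u v)
    inNbhd? v u = S? u ×-dec adj? u v

    nbhdIn : Fin n → Subset n
    nbhdIn v = toSubset (inNbhd? v)

    strictlyCorners⇒nbhdIn-⊂ : ∀ {w v} → StrictlyCorners G S w v → nbhdIn v ⊂ nbhdIn w
    strictlyCorners⇒nbhdIn-⊂ {w} {v} (_ , _ , _ , sub , u , u∈S , uw , ¬uv) =
      (λ x∈ → let (x∈S , xv) = ∈-toSubset⁻ (inNbhd? v) x∈ in ∈-toSubset⁺ (inNbhd? w) (x∈S , sub _ x∈S xv))
      , u , ∈-toSubset⁺ (inNbhd? w) (u∈S , uw) , ¬uv ∘ proj₂ ∘ ∈-toSubset⁻ (inNbhd? v)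

    uncorneredAbove : ∀ {v} → S v → UncorneredAbove S v
    uncorneredAbove {v} v∈S = climb v v∈S (⊃-wellFounded (nbhdIn v))
      where
      open UncorneredAbove
      climb : ∀ v → S v → Acc _⊃_ (nbhdIn v) → UncorneredAbove S v
      climb v v∈S (acc rec) with strictCorner? S S? v
      ... | no ¬sc = record { top = v ; top∈S = v∈S ; top-uncornered = ¬sc ; top-corners = λ _ _ uv → uv }
      ... | yes (w , wv@(_ , w∈S , _ , sub , _)) =
        let above = climb w w∈S (rec (strictlyCorners⇒nbhdIn-⊂ wv))
        in record { top = top above ; top∈S = top∈S above ; top-uncornered = top-uncornered above
                  ; top-corners = λ u u∈S uv → top-corners above u u∈S (sub u u∈S uv) }

  retract       : ℕ → Fin n → Fin n
  retract-stage : ∀ m c → stage G m (retract m c)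
  retract-climb : ∀ m c → UncorneredAbove (stage G m) (retract m c)

  retract zero    c = c
  retract (suc m) c = UncorneredAbove.top (retract-climb m c)

  retract-stage zero    c = tt
  retract-stage (suc m) c =
    UncorneredAbove.top∈S (retract-climb m c) , UncorneredAbove.top-uncornered (retract-climb m c)

  retract-climb m c = uncorneredAbove (stage G m) (stage? m) (retract-stage m c)

  retract-step : ∀ m c → Corners (stage G m) (retract (suc m) c) (retract m c)
  retract-step m c = UncorneredAbove.top-corners (retract-climb m c)

  retract-corners : ∀ m c → Corners (stage G m) (retract m c) c
  retract-corners zero    c u _        uc = uc
  retract-corners (suc m) c u (u∈ , _) uc = retract-step m c u u∈ (retract-corners m c u u∈ uc)

  retract-adj : ∀ m {c r} → stage G m r → Adj c r → Adj (retract m c) r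
  retract-adj m {c} r∈ cr = adj-sym (retract-corners m c _ r∈ (adj-sym cr))

  retract-hom : ∀ m {a b} → Adj a b → Adj (retract m a) (retract m b)
  retract-hom zero    ab = ab
  retract-hom (suc m) {a} {b} ab =
    retract-step m b _ (proj₁ (retract-stage (suc m) a))
      (adj-sym (retract-step m a _ (retract-stage m b) (adj-sym (retract-hom m ab))))

  adjacentToAll-retract-suc : ∀ {m c} → AdjacentToAll (stage G m) (retract m c)
    → AdjacentToAll (stage G m) (retract (suc m) c)
  adjacentToAll-retract-suc {m} {c} all u u∈ = adj-sym (retract-step m c u u∈ (adj-sym (all u u∈)))

  -- In a stage, a vertex adjacent to all of it strictly corners every vertex it fails to
  -- absorb, so all survivors of the next stage are adjacent to the whole stage.
  adjacentToAll⇒nextStage-clique : ∀ {m y} → stage G m y → AdjacentToAll (stage G m) y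
    → IsClique G (stage G (suc m))
  adjacentToAll⇒nextStage-clique {m} {y} y∈ all v w (v∈ , v-uncornered) (w∈ , _) = survivor-adj w w∈
    where
    survivor-adj : AdjacentToAll (stage G m) v
    survivor-adj u u∈ with v ≟ y
    ... | yes refl = all u u∈
    ... | no v≢y = adj-sym (decidable-stable (adj? u v) λ ¬uv →
      v-uncornered (y , v∈ , y∈ , v≢y ∘ sym , (λ x x∈ _ → adj-sym (all x x∈)) , u , u∈ , adj-sym (all u u∈) , ¬uv))

  capturedInOne⇒adj : ∀ {c r} → CopWinsFrom G 1 c r → Adj c r
  capturedInOne⇒adj {r = r} (inj₁ refl)                   = adj-refl r
  capturedInOne⇒adj         (inj₂ (_ , cc′ , inj₁ refl))  = cc′
  capturedInOne⇒adj {c} {r} (inj₂ (_ , cc′ , inj₂ wins)) = subst (Adj c) (wins r (adj-refl r)) cc′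

  evades : ∀ m c r → stage G m r → ¬ Adj (retract m c) r → ¬ CopWinsFrom G (suc m) c r
  evades zero c r _ ¬cr wins = ¬cr (capturedInOne⇒adj wins)
  evades (suc m) c r r∈ ¬cr (inj₁ refl)                 = ¬cr (retract-adj (suc m) r∈ (adj-refl r))
  evades (suc m) c r r∈ ¬cr (inj₂ (_ , cc′ , inj₁ refl)) = ¬cr (retract-adj (suc m) r∈ cc′)
  evades (suc m) c r (r∈ , r-uncornered) ¬cr (inj₂ (c′ , cc′ , inj₂ wins))
    with retract (suc m) c′ ≟ r
  ... | yes refl = ¬cr (retract-hom (suc m) cc′)
  ... | no z≢r = r-uncornered (retract (suc m) c′ , r∈ , proj₁ (retract-stage (suc m) c′) , z≢r
    , z-corners-r , retract (suc m) c , proj₁ (retract-stage (suc m) c) , retract-hom (suc m) cc′ , ¬cr)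
    where
    reaches : ∀ w → stage G m w → Adj r w → Adj (retract m c′) w
    reaches w w∈ rw = decidable-stable (adj? _ w) λ ¬c′w → evades m c′ w w∈ ¬c′w (wins w rw)
    z-corners-r : Corners (stage G m) (retract (suc m) c′) r
    z-corners-r w w∈ wr = retract-step m c′ w w∈ (adj-sym (reaches w w∈ (adj-sym wr)))

  RobberSurvives : ℕ → Set
  RobberSurvives m = ∀ c₀ → ∃[ r₀ ] ¬ CopWinsFrom G m c₀ r₀

  CopWinsFrom-mono : ∀ {m k c r} → m ≤ k → CopWinsFrom G m c r → CopWinsFrom G k c r
  CopWinsFrom-mono {k = zero}  z≤n      c≡r = c≡r
  CopWinsFrom-mono {k = suc k} z≤n      c≡r = inj₁ c≡r
  CopWinsFrom-mono             (s≤s m≤k) (inj₁ c≡r) = inj₁ c≡r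
  CopWinsFrom-mono             (s≤s m≤k) (inj₂ (c′ , cc′ , inj₁ c′≡r)) = inj₂ (c′ , cc′ , inj₁ c′≡r)
  CopWinsFrom-mono             (s≤s m≤k) (inj₂ (c′ , cc′ , inj₂ wins)) =
    inj₂ (c′ , cc′ , inj₂ λ r′ rr′ → CopWinsFrom-mono m≤k (wins r′ rr′))

  robberSurvives⇒captAtLeast : ∀ {m} → RobberSurvives m → CaptAtLeast G (suc m)
  robberSurvives⇒captAtLeast {m} survives k (c₀ , wins) with k ≤? m
  ... | yes k≤m = ⊥-elim (proj₂ (survives c₀) (CopWinsFrom-mono k≤m (wins (proj₁ (survives c₀)))))
  ... | no k≰m = ≰⇒> k≰m

  robberSurvives-retract : ∀ m → (∀ c → ¬ AdjacentToAll (stage G m) (retract m c)) → RobberSurvives (suc m)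
  robberSurvives-retract m ¬all c with any? (λ r → stage? m r ×-dec ¬? (adj? (retract m c) r))
  ... | yes (r , r∈ , ¬cr) = r , evades m c r r∈ ¬cr
  ... | no ∄r = ⊥-elim (¬all c λ u u∈ → decidable-stable (adj? _ u) λ ¬cu → ∄r (u , u∈ , ¬cu))

  nonClique⇒robberSurvives₀ : ¬ IsClique G (stage G zero) → RobberSurvives zero
  nonClique⇒robberSurvives₀ ¬clique c with any? (λ r → ¬? (c ≟ r))
  ... | yes found = found
  ... | no ∄r = ⊥-elim (¬clique λ u v _ _ → subst₂ Adj (everything-is-c u) (everything-is-c v) (adj-refl c))
    where
    everything-is-c : ∀ u → c ≡ u
    everything-is-c u = decidable-stable (c ≟ u) λ c≢u → ∄r (u , c≢u)

corollary5p6 : (G : Graph) (α r : ℕ) → 2 ≤ α → r ≤ 1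
    → HasCornerRank G α → RCopWin G α r → CaptAtLeast G (α ∸ r)
corollary5p6 G (suc (suc a)) zero _ _ _ ¬oneCopWin =
  robberSurvives⇒captAtLeast G (robberSurvives-retract G a λ c all →
    ¬oneCopWin (retract G (suc a) c , retract-stage G (suc a) c , adjacentToAll-retract-suc G all))
corollary5p6 G (suc (suc zero)) (suc zero) _ _ rank _ =
  robberSurvives⇒captAtLeast G (nonClique⇒robberSurvives₀ G
    (proj₁ (HasCornerRank.earlier rank 1 ≤-refl ≤-refl)))
corollary5p6 G (suc (suc (suc b))) (suc zero) _ _ rank _ =
  robberSurvives⇒captAtLeast G (robberSurvives-retract G b λ c all →
    proj₁ (HasCornerRank.earlier rank (suc (suc b)) (s≤s z≤n) ≤-refl)
      (adjacentToAll⇒nextStage-clique G (retract-stage G b c) all))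
corollary5p6 G (suc (suc _)) (suc (suc _)) _ _ _ ()
corollary5p6 G (suc zero) _ (s≤s ()) _ _ _
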